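{- For $n,k\ge0$ let $p_{n,k}$ be the number of integers $m\in[0,a_{2n+1})$ whose Kentucky-2 legal decomposition has exactly $k$ summands, and set $p_{n,k}=0$ if $n<0$ or $k<0$. Then for all $n\ge2$ and $k\le\lfloor (n+1)/2\rfloor$, \[ p_{n,k}=2p_{n-2,k-1}+p_{n-1,k}. \]
   Context: The Kentucky-2 sequence $(a_n)_{n\ge1}$: index $\ell$ belongs to bin $\lceil \ell/2\rceil$. A legal decomposition of $m\ge0$ using $\{a_1,\dots,a_N\}$ is $m=a_{\ell_1}+\cdots+a_{\ell_k}$, $k\ge0$, $1\le\ell_1<\cdots<\ell_k\le N$, with $\lceil \ell_{j+1}/2\rceil-\lceil \ell_j/2\rceil\ge2$ for all $j$. The sequence is defined by $a_1=1$ and, for $N\ge1$, $a_{N+1}$ is the smallest positive integer with no legal decomposition using $\{a_1,\dots,a_N\}$ (first terms $1,2,3,4,5,8,11,16,\dots$). Every nonnegative integer has a unique legal decomposition. -}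

module Defs where

open import Data.Nat using (ℕ; zero; suc; _+_; _*_; _∸_; _≤_; _<_; _≤?_)
open import Data.Nat.DivMod using (_/_)
open import Data.Integer using (ℤ; +_; -[1+_])
open import Data.List using (List; []; _∷_; _++_; map; length; filter; upTo)
open import Data.Nat.ListAction using (sum)
open import Data.List.Relation.Unary.Any using (Any; any?)
open import Data.List.Relation.Unary.Linked using (Linked; linked?)
open import Data.Product using (_×_)
open import Relation.Nullary using (Dec; yes; no; does)
open import Relation.Nullary.Decidable using (_×-dec_)
open import Relation.Binary.PropositionalEquality using (_≡_)
open import Data.Bool using (if_then_else_)

sublists : {A : Set} → List A → List (List A)
sublists [] = [] ∷ []
sublists (x ∷ xs) = sublists xs ++ map (x ∷_) (sublists xs)

indexSets : ℕ → List (List ℕ)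
indexSets N = sublists (map suc (upTo N))

bin : ℕ → ℕ
bin ℓ = (ℓ + 1) / 2

Legal : List ℕ → Set
Legal = Linked (λ i j → bin i + 2 ≤ bin j)

legal? : (L : List ℕ) → Dec (Legal L)
legal? = linked? (λ i j → bin i + 2 ≤? bin j)

-- 0-based lookup with default 0
at : List ℕ → ℕ → ℕ
at [] _ = 0
at (x ∷ xs) zero = x
at (x ∷ xs) (suc i) = at xs i

-- value of an index list L (1-based indices) w.r.t. the list of terms t = [a_1, ..., a_N]
value : List ℕ → List ℕ → ℕ
value t L = sum (map (λ ℓ → at t (ℓ ∸ 1)) L)

IsDecomp : List ℕ → ℕ → List ℕ → Set
IsDecomp t m L = Legal L × value t L ≡ m

isDecomp? : (t : List ℕ) (m : ℕ) (L : List ℕ) → Dec (IsDecomp t m L)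
isDecomp? t m L = legal? L ×-dec (value t L Data.Nat.≟ m)

Representable : List ℕ → ℕ → Set
Representable t m = Any (IsDecomp t m) (indexSets (length t))

representable? : (t : List ℕ) (m : ℕ) → Dec (Representable t m)
representable? t m = any? (isDecomp? t m) (indexSets (length t))

findFrom : List ℕ → ℕ → ℕ → ℕ
findFrom t zero m = m
findFrom t (suc f) m = if does (representable? t m) then findFrom t f (suc m) else m

-- next term: smallest positive integer with no legal decomposition using t.
-- (sum t + 1 is never representable, so searching 1 .. sum t + 1 suffices.)
next : List ℕ → ℕ
next t = findFrom t (sum t) 1

terms : ℕ → List ℕ
terms zero = []
terms (suc zero) = 1 ∷ []
terms (suc (suc N)) = terms (suc N) ++ (next (terms (suc N)) ∷ [])

-- the Kentucky-2 sequence, a ℓ for ℓ ≥ 1 (a 0 = 0 is an unused dummy value)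
a : ℕ → ℕ
a ℓ = at (terms ℓ) (ℓ ∸ 1)

HasKSummands : ℕ → ℕ → ℕ → Set
HasKSummands n k m = Any (λ L → IsDecomp (terms (2 * n + 1)) m L × length L ≡ k) (indexSets (2 * n + 1))

hasKSummands? : (n k m : ℕ) → Dec (HasKSummands n k m)
hasKSummands? n k m =
  any? (λ L → isDecomp? (terms (2 * n + 1)) m L ×-dec (length L Data.Nat.≟ k)) (indexSets (2 * n + 1))

p : ℕ → ℕ → ℕ
p n k = length (filter (hasKSummands? n k) (upTo (a (2 * n + 1))))

pℤ : ℤ → ℤ → ℕ
pℤ (+ n) (+ k) = p n k
pℤ (+ n) -[1+ _ ] = 0
pℤ -[1+ _ ] _ = 0

module Submission where

-- 1. A closed form.  Put F 0 = 1, F 1 = 3, F (b+2) = F (b+1) + 2 F b.  Bin b+1 of the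
--    sequence should hold a_{2b+1} = F b and a_{2b+2} = F b + F (b-1); the function A below
--    lists these numbers, and A is shown to be the Kentucky-2 sequence.
-- 2. Decompositions with respect to A, by induction on the number of bins.  A legal set of
--    indices either avoids the top index or is L ++ [top] with L using bins at least two
--    below.  This yields: the legal index sets in {1..2b} have values exactly [0, F b),
--    and the number of summands of m is summandsE b m, an explicit recursive function
--    (summandsO is the analogue for {1..2b+1}).
-- 3. Since legal index sets in {1..N} cover exactly [0, A (N+1)), the greedy definition of
--    the sequence produces A, so p n k counts the m < F n with summandsE n m = k.
-- 4. Splitting [0, F (b+2)) into [0, F (b+1)) and two windows of length F b (the values
--    using index 2b+3, resp. 2b+4) gives p (b+2) k = p (b+1) k + 2 p b (k-1).

open import Defs
open import Data.Nat using (ℕ; zero; suc; _+_; _*_; _∸_; _≤_; _<_; _≤′_; _<?_; _≟_;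
  z≤n; s≤s; ≤′-refl; ≤′-step)
open import Data.Nat.Properties
open import Data.Nat.Divisibility using (divides-refl)
open import Data.Nat.DivMod using (_/_; +-distrib-/-∣ʳ; /-mono-≤)
open import Data.Nat.ListAction using (sum)
open import Data.Nat.ListAction.Properties using (sum-++)
open import Data.Nat.Tactic.RingSolver using (solve-∀)
open import Data.Integer using (+_) renaming (_-_ to _-ℤ_)
open import Data.List using (List; []; _∷_; _++_; map; length; filter; upTo; applyUpTo)
open import Data.List.Properties using (length-++; map-++; applyUpTo-∷ʳ; length-applyUpTo; filter-++; upTo-∷ʳ)
open import Data.List.Membership.Propositional using (_∈_; find; lose)
open import Data.List.Membership.Propositional.Properties using (∈-map⁺; ∈-map⁻; ∈-++⁺ˡ; ∈-++⁺ʳ; ∈-++⁻; ∈-upTo⁻)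
open import Data.List.Relation.Unary.Any using (Any; here; there)
open import Data.List.Relation.Unary.All as All using (All; []; _∷_)
import Data.List.Relation.Unary.All.Properties as AllProp
open import Data.List.Relation.Unary.AllPairs using (AllPairs; []; _∷_)
import Data.List.Relation.Unary.AllPairs.Properties as AllPairsProp
open import Data.List.Relation.Unary.Linked using (Linked; [])
open import Data.List.Relation.Unary.Linked.Properties using (AllPairs⇒Linked; Linked⇒AllPairs)
open import Data.Product using (Σ; _×_; _,_; proj₁; proj₂)
open import Data.Sum using (_⊎_; inj₁; inj₂)
open import Data.Empty using (⊥-elim)
open import Data.Bool using (true; false; if_then_else_)
open import Function using (_∘_; _⇔_; mk⇔)
open import Relation.Nullary using (yes; no; does; ¬_)
open import Relation.Nullary.Decidable using (dec-true; dec-false; does-⇔)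
open import Relation.Unary using (Decidable)
open import Relation.Binary using (Transitive)
open import Relation.Binary.PropositionalEquality using (_≡_; refl; sym; trans; cong; cong₂; subst; module ≡-Reasoning)

-- F b = a_{2b+1}, the first term of bin b+1:  1, 3, 5, 11, 21, 43, ...
F : ℕ → ℕ
F zero = 1
F (suc zero) = 3
F (suc (suc b)) = F (suc b) + 2 * F b

-- double b = 2b, defined so that double (suc b) unfolds to suc (suc (double b)).
double : ℕ → ℕ
double zero = zero
double (suc b) = suc (suc (double b))

-- termFrom c ℓ = a_{2c+ℓ+1}: bin c+1 consists of F c and F c + F (c ∸ 1).
termFrom : ℕ → ℕ → ℕ
termFrom c zero = F c
termFrom c (suc zero) = F c + F (c ∸ 1)
termFrom c (suc (suc ℓ)) = termFrom (suc c) ℓ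

-- A ℓ is the claimed value of a_ℓ (A 0 is a dummy).
A : ℕ → ℕ
A zero = 0
A (suc ℓ) = termFrom 0 ℓ

termFrom-odd : ∀ c b → termFrom c (double b) ≡ F (c + b)
termFrom-odd c zero = cong F (sym (+-identityʳ c))
termFrom-odd c (suc b) = trans (termFrom-odd (suc c) b) (cong F (sym (+-suc c b)))

termFrom-even : ∀ c b → termFrom c (suc (double b)) ≡ F (c + b) + F (c + b ∸ 1)
termFrom-even c zero rewrite +-identityʳ c = refl
termFrom-even c (suc b) rewrite termFrom-even (suc c) b | +-suc c b = refl

A-odd : ∀ b → A (suc (double b)) ≡ F b
A-odd = termFrom-odd 0

A-even : ∀ b → A (suc (suc (double b))) ≡ F b + F (b ∸ 1)
A-even = termFrom-even 0

-- The recurrence of F, valid also for b = 0 with F (0 ∸ 1) = F 0.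
F-suc : ∀ b → F (suc b) ≡ F b + 2 * F (b ∸ 1)
F-suc zero = refl
F-suc (suc b) = refl

-- a_{2b+3} = a_{2b-1} + a_{2b+2}: the values above a_{2b+2} in bin b+2 form a window of
-- length F (b ∸ 1).
F-suc-split : ∀ b → F (suc b) ≡ F (b ∸ 1) + (F b + F (b ∸ 1))
F-suc-split b = trans (F-suc b) (rearrange (F b) (F (b ∸ 1)))
  where
  rearrange : ∀ x y → x + 2 * y ≡ y + (x + y)
  rearrange = solve-∀

F-≤-suc : ∀ b → F b ≤ F (suc b)
F-≤-suc b rewrite F-suc b = m≤m+n (F b) _

F-pred-≤ : ∀ b → F (b ∸ 1) ≤ F b
F-pred-≤ zero = ≤-refl
F-pred-≤ (suc b) = F-≤-suc b

F-pos : ∀ b → 1 ≤ F b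
F-pos zero = ≤-refl
F-pos (suc b) = ≤-trans (F-pos b) (F-≤-suc b)

termFrom-pos : ∀ c ℓ → 1 ≤ termFrom c ℓ
termFrom-pos c zero = F-pos c
termFrom-pos c (suc zero) = ≤-trans (F-pos c) (m≤m+n _ _)
termFrom-pos c (suc (suc ℓ)) = termFrom-pos (suc c) ℓ

-- Consecutive terms at most double; this bounds the search performed by `next`.
termFrom-growth : ∀ c ℓ → termFrom c (suc ℓ) ≤ 2 * termFrom c ℓ
termFrom-growth c zero = +-monoʳ-≤ (F c) (≤-trans (F-pred-≤ c) (≤-reflexive (sym (+-identityʳ _))))
termFrom-growth c (suc zero) rewrite F-suc c | *-distribˡ-+ 2 (F c) (F (c ∸ 1)) =
  +-monoˡ-≤ (2 * F (c ∸ 1)) (m≤m+n (F c) _)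
termFrom-growth c (suc (suc ℓ)) = termFrom-growth (suc c) ℓ

bin-suc-suc : ∀ ℓ → bin (suc (suc ℓ)) ≡ suc (bin ℓ)
bin-suc-suc ℓ = trans (cong (_/ 2) (+-comm 2 (ℓ + 1)))
  (trans (+-distrib-/-∣ʳ (ℓ + 1) (divides-refl 1)) (+-comm ((ℓ + 1) / 2) 1))

bin-double : ∀ b → bin (double b) ≡ b
bin-double zero = refl
bin-double (suc b) = trans (bin-suc-suc (double b)) (cong suc (bin-double b))

bin-suc-double : ∀ b → bin (suc (double b)) ≡ suc b
bin-suc-double zero = refl
bin-suc-double (suc b) = trans (bin-suc-suc (suc (double b))) (cong suc (bin-suc-double b))

≤-double-bin : ∀ x → x ≤ double (bin x)
≤-double-bin zero = z≤n
≤-double-bin (suc zero) = s≤s z≤n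
≤-double-bin (suc (suc x)) rewrite bin-suc-suc x = s≤s (s≤s (≤-double-bin x))

bin-mono : ∀ {x y} → x ≤ y → bin x ≤ bin y
bin-mono h = /-mono-≤ (+-monoˡ-≤ 1 h) ≤-refl

double-mono : ∀ {b c} → b ≤ c → double b ≤ double c
double-mono z≤n = z≤n
double-mono (s≤s h) = s≤s (s≤s (double-mono h))

Precedes : ℕ → ℕ → Set
Precedes i j = bin i + 2 ≤ bin j

Precedes-trans : Transitive Precedes
Precedes-trans {i} {j} h1 h2 = ≤-trans h1 (≤-trans (m≤m+n (bin j) 2) h2)

precedes⇒≤ : ∀ x b → bin x + 2 ≤ suc b → x ≤ double (b ∸ 1)
precedes⇒≤ x b h = ≤-trans (≤-double-bin x)
  (double-mono (subst (_≤ b ∸ 1) (m+n∸n≡m (bin x) 2) (∸-monoˡ-≤ 2 h)))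

≤⇒precedes : ∀ x b → 1 ≤ x → x ≤ double (b ∸ 1) → bin x + 2 ≤ suc b
≤⇒precedes (suc x) zero _ ()
≤⇒precedes x (suc b) _ h =
  ≤-trans (+-monoˡ-≤ 2 (subst (bin x ≤_) (bin-double b) (bin-mono h))) (≤-reflexive (+-comm b 2))

module _ {X : Set} {R : X → X → Set} (R-trans : Transitive R) where

  allPairs-snoc⁻ : ∀ {xs y} → AllPairs R (xs ++ y ∷ []) → AllPairs R xs × All (λ x → R x y) xs
  allPairs-snoc⁻ {[]} _ = [] , []
  allPairs-snoc⁻ {x ∷ xs} (px ∷ pxs) with allPairs-snoc⁻ {xs} pxs
  ... | pairs , toY = (AllProp.++⁻ˡ xs px ∷ pairs) , (All.head (AllProp.++⁻ʳ xs px) ∷ toY)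

  linked-snoc⁻ : ∀ {xs y} → Linked R (xs ++ y ∷ []) → Linked R xs × All (λ x → R x y) xs
  linked-snoc⁻ lk with allPairs-snoc⁻ (Linked⇒AllPairs R-trans lk)
  ... | pairs , toY = AllPairs⇒Linked pairs , toY

  linked-snoc⁺ : ∀ {xs y} → Linked R xs → All (λ x → R x y) xs → Linked R (xs ++ y ∷ [])
  linked-snoc⁺ lk toY = AllPairs⇒Linked
    (AllPairsProp.++⁺ (Linked⇒AllPairs R-trans lk) ([] ∷ []) (All.map (_∷ []) toY))

legal-snoc⁻ : ∀ {L y} → Legal (L ++ y ∷ []) → Legal L × All (λ x → Precedes x y) L
legal-snoc⁻ = linked-snoc⁻ (λ {i} {j} {k} → Precedes-trans {i} {j} {k})

legal-snoc⁺ : ∀ {L y} → Legal L → All (λ x → Precedes x y) L → Legal (L ++ y ∷ [])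
legal-snoc⁺ = linked-snoc⁺ (λ {i} {j} {k} → Precedes-trans {i} {j} {k})

module _ {X : Set} where

  sublists-snoc⁻ : ∀ (xs : List X) y {L} → L ∈ sublists (xs ++ y ∷ []) →
    L ∈ sublists xs ⊎ Σ (List X) (λ L' → L ≡ L' ++ y ∷ [] × L' ∈ sublists xs)
  sublists-snoc⁻ [] y (here refl) = inj₁ (here refl)
  sublists-snoc⁻ [] y (there (here refl)) = inj₂ ([] , refl , here refl)
  sublists-snoc⁻ (x ∷ xs) y mem with ∈-++⁻ (sublists (xs ++ y ∷ [])) mem
  ... | inj₁ m with sublists-snoc⁻ xs y m
  ...   | inj₁ m' = inj₁ (∈-++⁺ˡ m')
  ...   | inj₂ (L' , eq , m') = inj₂ (L' , eq , ∈-++⁺ˡ m')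
  sublists-snoc⁻ (x ∷ xs) y mem | inj₂ m with ∈-map⁻ (x ∷_) m
  ... | M , mM , refl with sublists-snoc⁻ xs y mM
  ...   | inj₁ m' = inj₁ (∈-++⁺ʳ (sublists xs) (∈-map⁺ (x ∷_) m'))
  ...   | inj₂ (M' , refl , m') = inj₂ (x ∷ M' , refl , ∈-++⁺ʳ (sublists xs) (∈-map⁺ (x ∷_) m'))

  sublists-snoc⁺ˡ : ∀ (xs : List X) y {L} → L ∈ sublists xs → L ∈ sublists (xs ++ y ∷ [])
  sublists-snoc⁺ˡ [] y (here refl) = here refl
  sublists-snoc⁺ˡ (x ∷ xs) y mem with ∈-++⁻ (sublists xs) mem
  ... | inj₁ m = ∈-++⁺ˡ (sublists-snoc⁺ˡ xs y m)
  ... | inj₂ m with ∈-map⁻ (x ∷_) m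
  ...   | M , mM , refl = ∈-++⁺ʳ (sublists (xs ++ y ∷ [])) (∈-map⁺ (x ∷_) (sublists-snoc⁺ˡ xs y mM))

  sublists-snoc⁺ʳ : ∀ (xs : List X) y {L} → L ∈ sublists xs → (L ++ y ∷ []) ∈ sublists (xs ++ y ∷ [])
  sublists-snoc⁺ʳ [] y (here refl) = there (here refl)
  sublists-snoc⁺ʳ (x ∷ xs) y mem with ∈-++⁻ (sublists xs) mem
  ... | inj₁ m = ∈-++⁺ˡ (sublists-snoc⁺ʳ xs y m)
  ... | inj₂ m with ∈-map⁻ (x ∷_) m
  ...   | M , mM , refl = ∈-++⁺ʳ (sublists (xs ++ y ∷ [])) (∈-map⁺ (x ∷_) (sublists-snoc⁺ʳ xs y mM))

  sublists-⊆ : ∀ (xs : List X) {L} → L ∈ sublists xs → All (_∈ xs) L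
  sublists-⊆ [] (here refl) = []
  sublists-⊆ (x ∷ xs) mem with ∈-++⁻ (sublists xs) mem
  ... | inj₁ m = All.map there (sublists-⊆ xs m)
  ... | inj₂ m with ∈-map⁻ (x ∷_) m
  ...   | M , mM , refl = here refl ∷ All.map there (sublists-⊆ xs mM)

indices-snoc : ∀ N → map suc (upTo (suc N)) ≡ map suc (upTo N) ++ suc N ∷ []
indices-snoc N = trans (cong (map suc) (sym (upTo-∷ʳ N))) (map-++ suc (upTo N) (N ∷ []))

indexSets-suc⁻ : ∀ N {L} → L ∈ indexSets (suc N) →
  L ∈ indexSets N ⊎ Σ (List ℕ) (λ L' → L ≡ L' ++ suc N ∷ [] × L' ∈ indexSets N)
indexSets-suc⁻ N {L} mem =
  sublists-snoc⁻ (map suc (upTo N)) (suc N) (subst (λ xs → L ∈ sublists xs) (indices-snoc N) mem)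

indexSets-lift : ∀ N {L} → L ∈ indexSets N → L ∈ indexSets (suc N)
indexSets-lift N {L} mem =
  subst (λ xs → L ∈ sublists xs) (sym (indices-snoc N)) (sublists-snoc⁺ˡ (map suc (upTo N)) (suc N) mem)

indexSets-snoc : ∀ N {L} → L ∈ indexSets N → (L ++ suc N ∷ []) ∈ indexSets (suc N)
indexSets-snoc N {L} mem = subst (λ xs → (L ++ suc N ∷ []) ∈ sublists xs) (sym (indices-snoc N))
  (sublists-snoc⁺ʳ (map suc (upTo N)) (suc N) mem)

indexSets-mono : ∀ {K N L} → K ≤ N → L ∈ indexSets K → L ∈ indexSets N
indexSets-mono {K} {N} K≤N = go {K} {N} (≤⇒≤′ K≤N)
  where
  go : ∀ {K N L} → K ≤′ N → L ∈ indexSets K → L ∈ indexSets N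
  go ≤′-refl mem = mem
  go {N = suc N} (≤′-step h) mem = indexSets-lift N (go h mem)

indexSets-shrink : ∀ N {K L} → L ∈ indexSets N → All (_≤ K) L → L ∈ indexSets K
indexSets-shrink zero {K} (here refl) _ = indexSets-mono {0} {K} z≤n (here refl)
indexSets-shrink (suc N) mem below with indexSets-suc⁻ N mem
... | inj₁ mem' = indexSets-shrink N mem' below
... | inj₂ (L' , refl , mem') = indexSets-mono {suc N} (All.lookup below (∈-++⁺ʳ L' (here refl))) mem

indexSets-bounds : ∀ N {L} → L ∈ indexSets N → All (λ z → 1 ≤ z × z ≤ N) L
indexSets-bounds N mem = All.map bounds (sublists-⊆ _ mem)
  where
  bounds : ∀ {z} → z ∈ map suc (upTo N) → 1 ≤ z × z ≤ N
  bounds z∈ with ∈-map⁻ suc z∈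
  ... | i , i∈ , refl = s≤s z≤n , ∈-upTo⁻ i∈

valueA : List ℕ → ℕ
valueA L = sum (map A L)

valueA-snoc : ∀ L y → valueA (L ++ y ∷ []) ≡ valueA L + A y
valueA-snoc L y rewrite map-++ A L (y ∷ []) | sum-++ (map A L) (A y ∷ []) | +-identityʳ (A y) = refl

length-snoc : ∀ (L : List ℕ) y → length (L ++ y ∷ []) ≡ suc (length L)
length-snoc L y = trans (length-++ L) (+-comm (length L) 1)

Decomposition : ℕ → ℕ → Set
Decomposition N m = Σ (List ℕ) λ L → L ∈ indexSets N × Legal L × valueA L ≡ m

drop-top : ∀ N b {L} → bin (suc N) ≡ suc b → L ∈ indexSets N → Legal (L ++ suc N ∷ []) →
  L ∈ indexSets (double (b ∸ 1)) × Legal L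
drop-top N b top mem lg with legal-snoc⁻ lg
... | lgL , below =
  indexSets-shrink N mem (All.map (λ {z} h → precedes⇒≤ z b (subst (bin z + 2 ≤_) top h)) below) , lgL

add-top : ∀ N b {L} → bin (suc N) ≡ suc b → double (b ∸ 1) ≤ N →
  L ∈ indexSets (double (b ∸ 1)) → Legal L →
  (L ++ suc N ∷ []) ∈ indexSets (suc N) × Legal (L ++ suc N ∷ [])
add-top N b top le mem lg =
  indexSets-snoc N (indexSets-mono le mem) ,
  legal-snoc⁺ lg (All.map (λ {z} (pos , z≤) → subst (bin z + 2 ≤_) (sym top) (≤⇒precedes z b pos z≤))
    (indexSets-bounds _ mem))

caseBelow : ℕ → ℕ → ℕ → ℕ → ℕ
caseBelow m x u v = if does (m <? x) then u else v

caseBelow-< : ∀ {m x u v} → m < x → caseBelow m x u v ≡ u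
caseBelow-< {m} {x} {u} {v} h = cong (if_then u else v) (dec-true (m <? x) h)

caseBelow-≥ : ∀ {m x u v} → x ≤ m → caseBelow m x u v ≡ v
caseBelow-≥ {m} {x} {u} {v} h = cong (if_then u else v) (dec-false (m <? x) (≤⇒≯ h))

-- summandsO b m (resp. summandsE b m): the number of summands of the legal decomposition
-- of m by the indices {1..2b+1} (resp. {1..2b}).  The top index is used iff m is at least
-- its term, and then the remaining summands use indices {1..2(b-1)}.
summandsO : ℕ → ℕ → ℕ
summandsE : ℕ → ℕ → ℕ

summandsO zero m = caseBelow m (F 0) (summandsE 0 m) (suc (summandsE 0 (m ∸ F 0)))
summandsO (suc b) m = caseBelow m (F (suc b)) (summandsE (suc b) m) (suc (summandsE b (m ∸ F (suc b))))

summandsE zero m = 0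
summandsE (suc zero) m = caseBelow m (F 0 + F 0) (summandsO 0 m) (suc (summandsE 0 (m ∸ (F 0 + F 0))))
summandsE (suc (suc b)) m =
  caseBelow m (F (suc b) + F b) (summandsO (suc b) m) (suc (summandsE b (m ∸ (F (suc b) + F b))))

summandsO-eq : ∀ b m →
  summandsO b m ≡ caseBelow m (F b) (summandsE b m) (suc (summandsE (b ∸ 1) (m ∸ F b)))
summandsO-eq zero m = refl
summandsO-eq (suc b) m = refl

summandsE-eq : ∀ b m → summandsE (suc b) m ≡
  caseBelow m (F b + F (b ∸ 1)) (summandsO b m) (suc (summandsE (b ∸ 1) (m ∸ (F b + F (b ∸ 1)))))
summandsE-eq zero m = refl
summandsE-eq (suc b) m = refl

summandsO-below : ∀ b {m} → m < F b → summandsO b m ≡ summandsE b m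
summandsO-below b {m} h = trans (summandsO-eq b m) (caseBelow-< h)

summandsO-above : ∀ b {m} → F b ≤ m → summandsO b m ≡ suc (summandsE (b ∸ 1) (m ∸ F b))
summandsO-above b {m} h = trans (summandsO-eq b m) (caseBelow-≥ h)

summandsE-below : ∀ b {m} → m < F b + F (b ∸ 1) → summandsE (suc b) m ≡ summandsO b m
summandsE-below b {m} h = trans (summandsE-eq b m) (caseBelow-< h)

summandsE-above : ∀ b {m} → F b + F (b ∸ 1) ≤ m →
  summandsE (suc b) m ≡ suc (summandsE (b ∸ 1) (m ∸ (F b + F (b ∸ 1))))
summandsE-above b {m} h = trans (summandsE-eq b m) (caseBelow-≥ h)

CountedE : ℕ → Set
CountedE b = ∀ {L} → L ∈ indexSets (double b) → Legal L →
  valueA L < F b × length L ≡ summandsE b (valueA L)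

CountedO : ℕ → Set
CountedO b = ∀ {L} → L ∈ indexSets (suc (double b)) → Legal L →
  valueA L < F b + F (b ∸ 1) × length L ≡ summandsO b (valueA L)

-- Index sets in {1..2b+1}: those avoiding 2b+1 are handled by CountedE b; for the others
-- the value lies in the window [F b, F b + F (b-1)) and there is one more summand.
countedO : ∀ b → CountedE b → CountedE (b ∸ 1) → CountedO b
countedO b countedB _ mem lg with indexSets-suc⁻ (double b) mem
... | inj₁ mem' with countedB mem' lg
...   | bound , len = <-≤-trans bound (m≤m+n _ _) , trans len (sym (summandsO-below b bound))
countedO b _ countedB' mem lg | inj₂ (L , refl , mem')
    with drop-top (double b) b (bin-suc-double b) mem' lg
... | memL , lgL with countedB' memL lgL
... | bound , len = bound-top , length-top
  where
  v : ℕ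
  v = valueA L
  value-top : valueA (L ++ suc (double b) ∷ []) ≡ v + F b
  value-top = trans (valueA-snoc L _) (cong (λ t → v + t) (A-odd b))
  bound-top : valueA (L ++ suc (double b) ∷ []) < F b + F (b ∸ 1)
  bound-top rewrite value-top = subst (v + F b <_) (+-comm (F (b ∸ 1)) (F b)) (+-monoˡ-< (F b) bound)
  length-top : length (L ++ suc (double b) ∷ []) ≡ summandsO b (valueA (L ++ suc (double b) ∷ []))
  length-top rewrite value-top | summandsO-above b (m≤n+m (F b) v) | m+n∸n≡m v (F b) =
    trans (length-snoc L _) (cong suc len)

-- Index sets in {1..2b+2}: those avoiding 2b+2 are handled by countedO; for the others the
-- value lies in [F b + F (b-1), F (b+1)) and there is one more summand.
countedE-suc : ∀ b → CountedE b → CountedE (b ∸ 1) → CountedE (suc b)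
countedE-suc b countedB countedB' mem lg with indexSets-suc⁻ (suc (double b)) mem
... | inj₁ mem' with countedO b countedB countedB' mem' lg
...   | bound , len =
  <-≤-trans bound (subst (F b + F (b ∸ 1) ≤_) (sym (F-suc-split b)) (m≤n+m _ (F (b ∸ 1)))) ,
  trans len (sym (summandsE-below b bound))
countedE-suc b _ countedB' mem lg | inj₂ (L , refl , mem')
    with drop-top (suc (double b)) b (bin-double (suc b)) mem' lg
... | memL , lgL with countedB' memL lgL
... | bound , len = bound-top , length-top
  where
  v : ℕ
  v = valueA L
  t : ℕ
  t = F b + F (b ∸ 1)
  value-top : valueA (L ++ suc (suc (double b)) ∷ []) ≡ v + t
  value-top = trans (valueA-snoc L _) (cong (λ u → v + u) (A-even b))
  bound-top : valueA (L ++ suc (suc (double b)) ∷ []) < F (suc b)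
  bound-top rewrite value-top | F-suc-split b = +-monoˡ-< t bound
  length-top : length (L ++ suc (suc (double b)) ∷ []) ≡
               summandsE (suc b) (valueA (L ++ suc (suc (double b)) ∷ []))
  length-top rewrite value-top | summandsE-above b (m≤n+m t v) | m+n∸n≡m v t =
    trans (length-snoc L _) (cong suc len)

countedE-zero : CountedE 0
countedE-zero (here refl) _ = s≤s z≤n , refl

-- The induction step refers to two previous values of b, so both are carried along.
countedE-pair : ∀ b → CountedE b × CountedE (b ∸ 1)
countedE-pair zero = countedE-zero , countedE-zero
countedE-pair (suc b) with countedE-pair b
... | countedB , countedB' = countedE-suc b countedB countedB' , countedB

countedO-all : ∀ b → CountedO b
countedO-all b = countedO b (proj₁ (countedE-pair b)) (proj₂ (countedE-pair b))

CoveredE : ℕ → Set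
CoveredE b = ∀ {m} → m < F b → Decomposition (double b) m

∸-<-window : ∀ {m x y} → x ≤ m → m < x + y → m ∸ x < y
∸-<-window {m} {x} {y} x≤m h = +-cancelˡ-< x (m ∸ x) y (subst (_< x + y) (sym (m+[n∸m]≡n x≤m)) h)

-- Values below F b need no top index; the others are F b plus a value below F (b-1).
coveredO : ∀ b → CoveredE b → CoveredE (b ∸ 1) →
  ∀ {m} → m < F b + F (b ∸ 1) → Decomposition (suc (double b)) m
coveredO b coveredB coveredB' {m} h with m <? F b
... | yes below with coveredB below
...   | L , mem , lg , val = L , indexSets-lift (double b) mem , lg , val
coveredO b coveredB coveredB' {m} h | no ¬below with ≮⇒≥ ¬below
... | above with coveredB' (∸-<-window above h)
... | L , mem , lg , val with add-top (double b) b (bin-suc-double b) (double-mono (m∸n≤m b 1)) mem lg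
... | mem-top , lg-top =
  L ++ suc (double b) ∷ [] , mem-top , lg-top ,
  trans (valueA-snoc L _) (trans (cong₂ _+_ val (A-odd b)) (m∸n+n≡m above))

-- Values below F b + F (b-1) are covered by coveredO; the others are F b + F (b-1) plus a
-- value below F (b-1).
coveredE-suc : ∀ b → CoveredE b → CoveredE (b ∸ 1) → CoveredE (suc b)
coveredE-suc b coveredB coveredB' {m} h with m <? F b + F (b ∸ 1)
... | yes below with coveredO b coveredB coveredB' below
...   | L , mem , lg , val = L , indexSets-lift (suc (double b)) mem , lg , val
coveredE-suc b coveredB coveredB' {m} h | no ¬below with ≮⇒≥ ¬below
... | above with coveredB' (∸-<-window above (subst (m <_) (trans (F-suc-split b) (+-comm (F (b ∸ 1)) _)) h))
... | L , mem , lg , val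
    with add-top (suc (double b)) b (bin-double (suc b)) (≤-trans (double-mono (m∸n≤m b 1)) (n≤1+n _)) mem lg
... | mem-top , lg-top =
  L ++ suc (suc (double b)) ∷ [] , mem-top , lg-top ,
  trans (valueA-snoc L _) (trans (cong₂ _+_ val (A-even b)) (m∸n+n≡m above))

coveredE-zero : CoveredE 0
coveredE-zero {zero} _ = [] , here refl , [] , refl
coveredE-zero {suc m} (s≤s ())

coveredE-pair : ∀ b → CoveredE b × CoveredE (b ∸ 1)
coveredE-pair zero = coveredE-zero , coveredE-zero
coveredE-pair (suc b) with coveredE-pair b
... | coveredB , coveredB' = coveredE-suc b coveredB coveredB' , coveredB

parity : ∀ N → Σ ℕ λ b → N ≡ double b ⊎ N ≡ suc (double b)
parity zero = 0 , inj₁ refl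
parity (suc N) with parity N
... | b , inj₁ refl = b , inj₂ refl
... | b , inj₂ refl = suc b , inj₁ refl

value-bound : ∀ N {L} → L ∈ indexSets N → Legal L → valueA L < A (suc N)
value-bound N {L} mem lg with parity N
... | b , inj₁ refl = subst (valueA L <_) (sym (A-odd b)) (proj₁ (proj₁ (countedE-pair b) mem lg))
... | b , inj₂ refl = subst (valueA L <_) (sym (A-even b)) (proj₁ (countedO-all b mem lg))

decomposition : ∀ N {m} → m < A (suc N) → Decomposition N m
decomposition N {m} h with parity N
... | b , inj₁ refl = proj₁ (coveredE-pair b) (subst (m <_) (A-odd b) h)
... | b , inj₂ refl =
  coveredO b (proj₁ (coveredE-pair b)) (proj₂ (coveredE-pair b)) (subst (m <_) (A-even b) h)

closedTerms : ℕ → List ℕ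
closedTerms N = applyUpTo (A ∘ suc) N

at-applyUpTo : ∀ (h : ℕ → ℕ) N {i} → i < N → at (applyUpTo h N) i ≡ h i
at-applyUpTo h (suc N) {zero} _ = refl
at-applyUpTo h (suc N) {suc i} (s≤s i<N) = at-applyUpTo (h ∘ suc) N i<N

value-closedTerms : ∀ N {L} → L ∈ indexSets N → value (closedTerms N) L ≡ valueA L
value-closedTerms N mem = go (indexSets-bounds N mem)
  where
  go : ∀ {L} → All (λ z → 1 ≤ z × z ≤ N) L → value (closedTerms N) L ≡ valueA L
  go [] = refl
  go {suc z ∷ L} ((_ , z≤N) ∷ bounds) = cong₂ _+_ (at-applyUpTo (A ∘ suc) N z≤N) (go bounds)

indexSets-closedTerms : ∀ N → indexSets (length (closedTerms N)) ≡ indexSets N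
indexSets-closedTerms N = cong indexSets (length-applyUpTo (A ∘ suc) N)

representable⇒< : ∀ N {m} → Representable (closedTerms N) m → m < A (suc N)
representable⇒< N {m} rep
  with find (subst (Any (IsDecomp (closedTerms N) m)) (indexSets-closedTerms N) rep)
... | L , mem , (lg , val) = subst (_< A (suc N)) (trans (sym (value-closedTerms N mem)) val) (value-bound N mem lg)

<⇒representable : ∀ N {m} → m < A (suc N) → Representable (closedTerms N) m
<⇒representable N h with decomposition N h
... | L , mem , lg , val = subst (Any (IsDecomp (closedTerms N) _)) (sym (indexSets-closedTerms N))
  (lose mem (lg , trans (value-closedTerms N mem) val))

findFrom-spec : ∀ t fuel s r → s ≤ r → r ≤ s + fuel → (∀ m → m < r → Representable t m) →
  ¬ Representable t r → findFrom t fuel s ≡ r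
findFrom-spec t zero s r s≤r r≤ _ _ = ≤-antisym s≤r (subst (r ≤_) (+-identityʳ s) r≤)
findFrom-spec t (suc fuel) s r s≤r r≤ rep ¬rep with representable? t s | m≤n⇒m<n∨m≡n s≤r
... | yes _ | inj₁ s<r = findFrom-spec t fuel (suc s) r s<r (subst (r ≤_) (+-suc s fuel) r≤) rep ¬rep
... | yes repS | inj₂ refl = ⊥-elim (¬rep repS)
... | no ¬repS | inj₁ s<r = ⊥-elim (¬repS (rep s s<r))
... | no _ | inj₂ s≡r = s≡r

sum-closedTerms : ∀ N → sum (closedTerms (suc N)) ≡ sum (closedTerms N) + A (suc N)
sum-closedTerms N = trans (cong sum (sym (applyUpTo-∷ʳ (A ∘ suc) N)))
  (trans (sum-++ (closedTerms N) (A (suc N) ∷ [])) (cong (λ z → sum (closedTerms N) + z) (+-identityʳ _)))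

-- A (N+1) ≤ 1 + A 1 + ... + A N, so the search in `next` is long enough.
A-≤-sum : ∀ N → A (suc N) ≤ suc (sum (closedTerms N))
A-≤-sum zero = ≤-refl
A-≤-sum (suc N) rewrite sum-closedTerms N = begin
  A (suc (suc N))                 ≤⟨ termFrom-growth 0 N ⟩
  A (suc N) + (A (suc N) + 0)     ≡⟨ cong (_+_ (A (suc N))) (+-identityʳ _) ⟩
  A (suc N) + A (suc N)           ≤⟨ +-monoʳ-≤ (A (suc N)) (A-≤-sum N) ⟩
  A (suc N) + suc (sum (closedTerms N))   ≡⟨ +-suc (A (suc N)) _ ⟩
  suc (A (suc N) + sum (closedTerms N))   ≡⟨ cong suc (+-comm (A (suc N)) _) ⟩
  suc (sum (closedTerms N) + A (suc N))   ∎
  where open ≤-Reasoning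

next-closedTerms : ∀ N → next (closedTerms N) ≡ A (suc N)
next-closedTerms N = findFrom-spec (closedTerms N) (sum (closedTerms N)) 1 (A (suc N))
  (termFrom-pos 0 N) (A-≤-sum N) (λ _ → <⇒representable N) (λ rep → <-irrefl refl (representable⇒< N rep))

terms-closed : ∀ N → terms N ≡ closedTerms N
terms-closed zero = refl
terms-closed (suc zero) = refl
terms-closed (suc (suc N)) rewrite terms-closed (suc N) | next-closedTerms (suc N) =
  applyUpTo-∷ʳ (A ∘ suc) (suc N)

count : {P : ℕ → Set} → Decidable P → ℕ → ℕ
count P? zero = 0
count P? (suc X) = count P? X + (if does (P? X) then 1 else 0)

length-filter-upTo : ∀ {P : ℕ → Set} (P? : Decidable P) X → length (filter P? (upTo X)) ≡ count P? X
length-filter-upTo P? zero = refl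
length-filter-upTo P? (suc X) = begin
  length (filter P? (upTo (suc X)))                  ≡⟨ cong (length ∘ filter P?) (sym (upTo-∷ʳ X)) ⟩
  length (filter P? (upTo X ++ X ∷ []))              ≡⟨ cong length (filter-++ P? (upTo X) (X ∷ [])) ⟩
  length (filter P? (upTo X) ++ filter P? (X ∷ []))  ≡⟨ length-++ (filter P? (upTo X)) ⟩
  length (filter P? (upTo X)) + length (filter P? (X ∷ []))
    ≡⟨ cong₂ _+_ (length-filter-upTo P? X) length-filter-singleton ⟩
  count P? (suc X)                                   ∎
  where
  open ≡-Reasoning
  length-filter-singleton : length (filter P? (X ∷ [])) ≡ (if does (P? X) then 1 else 0)
  length-filter-singleton with does (P? X)
  ... | true = refl
  ... | false = refl

count-cong : ∀ {P Q : ℕ → Set} (P? : Decidable P) (Q? : Decidable Q) X →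
  (∀ m → m < X → does (P? m) ≡ does (Q? m)) → count P? X ≡ count Q? X
count-cong P? Q? zero _ = refl
count-cong P? Q? (suc X) same =
  cong₂ _+_ (count-cong P? Q? X (λ m m<X → same m (m<n⇒m<1+n m<X))) (cong (if_then 1 else 0) (same X ≤-refl))

count-+ : ∀ {P : ℕ → Set} (P? : Decidable P) X Y → count P? (X + Y) ≡ count P? X + count (λ j → P? (X + j)) Y
count-+ P? X zero = trans (cong (count P?) (+-identityʳ X)) (sym (+-identityʳ _))
count-+ P? X (suc Y) = begin
  count P? (X + suc Y)                                       ≡⟨ cong (count P?) (+-suc X Y) ⟩
  count P? (X + Y) + (if does (P? (X + Y)) then 1 else 0)    ≡⟨ cong (_+ _) (count-+ P? X Y) ⟩
  (count P? X + count (λ j → P? (X + j)) Y) + _              ≡⟨ +-assoc (count P? X) _ _ ⟩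
  count P? X + count (λ j → P? (X + j)) (suc Y)              ∎
  where open ≡-Reasoning

count-never : ∀ {P : ℕ → Set} (P? : Decidable P) X → (∀ m → ¬ P m) → count P? X ≡ 0
count-never P? zero _ = refl
count-never P? (suc X) never rewrite dec-false (P? X) (never X) = trans (+-identityʳ _) (count-never P? X never)

odd-index : ∀ n → 2 * n + 1 ≡ suc (double n)
odd-index n = trans (+-comm (2 * n) 1) (cong suc (twice n))
  where
  twice : ∀ n → 2 * n ≡ double n
  twice zero = refl
  twice (suc n) = trans (*-suc 2 n) (cong (suc ∘ suc) (twice n))

a-odd : ∀ n → a (2 * n + 1) ≡ F n
a-odd n rewrite odd-index n | terms-closed (suc (double n)) =
  trans (at-applyUpTo (A ∘ suc) (suc (double n)) ≤-refl) (A-odd n)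

summands-spec : ∀ n k N {m} → N ≡ suc (double n) → m < F n →
  Any (λ L → IsDecomp (terms N) m L × length L ≡ k) (indexSets N) ⇔ (summandsE n m ≡ k)
summands-spec n k N {m} refl m<F = mk⇔ to from
  where
  value-terms : ∀ {L} → L ∈ indexSets N → value (terms N) L ≡ valueA L
  value-terms {L} mem = trans (cong (λ t → value t L) (terms-closed N)) (value-closedTerms N mem)

  to : Any (λ L → IsDecomp (terms N) m L × length L ≡ k) (indexSets N) → summandsE n m ≡ k
  to has with find has
  ... | L , mem , ((lg , val) , len) = begin
    summandsE n m          ≡⟨ sym (summandsO-below n m<F) ⟩
    summandsO n m          ≡⟨ cong (summandsO n) (trans (sym val) (value-terms mem)) ⟩
    summandsO n (valueA L) ≡⟨ proj₂ (countedO-all n mem lg) ⟨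
    length L               ≡⟨ len ⟩
    k                      ∎
    where open ≡-Reasoning

  from : summandsE n m ≡ k → Any (λ L → IsDecomp (terms N) m L × length L ≡ k) (indexSets N)
  from summands≡k with proj₁ (coveredE-pair n) m<F
  ... | L , mem , lg , val = lose (indexSets-lift (double n) mem)
    ( (lg , trans (value-terms (indexSets-lift (double n) mem)) val)
    , trans (proj₂ (proj₁ (countedE-pair n) mem lg)) (trans (cong (summandsE n) val) summands≡k))

p-count : ∀ n k → p n k ≡ count (λ m → summandsE n m ≟ k) (F n)
p-count n k = begin
  p n k                                     ≡⟨ length-filter-upTo (hasKSummands? n k) (a (2 * n + 1)) ⟩
  count (hasKSummands? n k) (a (2 * n + 1)) ≡⟨ cong (count (hasKSummands? n k)) (a-odd n) ⟩
  count (hasKSummands? n k) (F n)           ≡⟨ count-cong (hasKSummands? n k) (λ m → summandsE n m ≟ k) (F n)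
                                                 (λ m m<F → does-⇔ (summands-spec n k (2 * n + 1) (odd-index n) m<F)
                                                                       (hasKSummands? n k m) (summandsE n m ≟ k)) ⟩
  count (λ m → summandsE n m ≟ k) (F n)     ∎
  where open ≡-Reasoning

-- [0, F (b+2)) splits into [0, F (b+1)), where the top bin is unused, and two windows
-- of length F b, whose elements use index 2b+3, resp. 2b+4, on top of a decomposition
-- by bins ≤ b.
summandsE-low : ∀ b {m} → m < F (suc b) → summandsE (suc (suc b)) m ≡ summandsE (suc b) m
summandsE-low b m<F = trans (summandsE-below (suc b) (<-≤-trans m<F (m≤m+n _ _))) (summandsO-below (suc b) m<F)

summandsE-middle : ∀ b {j} → j < F b → summandsE (suc (suc b)) (F (suc b) + j) ≡ suc (summandsE b j)
summandsE-middle b {j} j<F = begin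
  summandsE (suc (suc b)) (F (suc b) + j)        ≡⟨ summandsE-below (suc b) (+-monoʳ-< (F (suc b)) j<F) ⟩
  summandsO (suc b) (F (suc b) + j)              ≡⟨ summandsO-above (suc b) (m≤m+n _ j) ⟩
  suc (summandsE b (F (suc b) + j ∸ F (suc b)))  ≡⟨ cong (suc ∘ summandsE b) (m+n∸m≡n (F (suc b)) j) ⟩
  suc (summandsE b j)                            ∎
  where open ≡-Reasoning

summandsE-high : ∀ b j → summandsE (suc (suc b)) (F (suc b) + (F b + j)) ≡ suc (summandsE b j)
summandsE-high b j = begin
  summandsE (suc (suc b)) (F (suc b) + (F b + j))
    ≡⟨ cong (summandsE (suc (suc b))) (sym (+-assoc (F (suc b)) (F b) j)) ⟩
  summandsE (suc (suc b)) (F (suc b) + F b + j)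
    ≡⟨ summandsE-above (suc b) (m≤m+n _ j) ⟩
  suc (summandsE b (F (suc b) + F b + j ∸ (F (suc b) + F b)))
    ≡⟨ cong (suc ∘ summandsE b) (m+n∸m≡n (F (suc b) + F b) j) ⟩
  suc (summandsE b j) ∎
  where open ≡-Reasoning

shiftedCount : ℕ → ℕ → ℕ
shiftedCount b k = count (λ j → suc (summandsE b j) ≟ k) (F b)

shiftedCount-pℤ : ∀ b k → shiftedCount b k ≡ pℤ (+ b) (+ k -ℤ + 1)
shiftedCount-pℤ b zero = count-never _ (F b) (λ _ ())
shiftedCount-pℤ b (suc k) = trans (count-cong _ _ (F b) (λ _ _ → refl)) (sym (p-count b k))

count-recurrence : ∀ b k → count (λ m → summandsE (suc (suc b)) m ≟ k) (F (suc (suc b))) ≡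
  count (λ m → summandsE (suc b) m ≟ k) (F (suc b)) + 2 * shiftedCount b k
count-recurrence b k = begin
  count E₂ (F (suc b) + (F b + (F b + 0)))
    ≡⟨ count-+ E₂ (F (suc b)) _ ⟩
  count E₂ (F (suc b)) + count (λ j → E₂ (F (suc b) + j)) (F b + (F b + 0))
    ≡⟨ cong (_+_ (count E₂ (F (suc b)))) (count-+ (λ j → E₂ (F (suc b) + j)) (F b) (F b + 0)) ⟩
  count E₂ (F (suc b)) + (count (λ j → E₂ (F (suc b) + j)) (F b) +
                          count (λ j → E₂ (F (suc b) + (F b + j))) (F b + 0))
    ≡⟨ cong₂ _+_ low (cong₂ _+_ middle (trans (cong (count _) (+-identityʳ (F b)))
                                          (trans high (sym (+-identityʳ _))))) ⟩
  count E₁ (F (suc b)) + 2 * shiftedCount b k ∎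
  where
  open ≡-Reasoning
  E₁ : Decidable (λ m → summandsE (suc b) m ≡ k)
  E₁ m = summandsE (suc b) m ≟ k
  E₂ : Decidable (λ m → summandsE (suc (suc b)) m ≡ k)
  E₂ m = summandsE (suc (suc b)) m ≟ k
  low : count E₂ (F (suc b)) ≡ count E₁ (F (suc b))
  low = count-cong E₂ E₁ _ (λ m m<F → cong (λ s → does (s ≟ k)) (summandsE-low b m<F))
  middle : count (λ j → E₂ (F (suc b) + j)) (F b) ≡ shiftedCount b k
  middle = count-cong _ _ (F b) (λ j j<F → cong (λ s → does (s ≟ k)) (summandsE-middle b j<F))
  high : count (λ j → E₂ (F (suc b) + (F b + j))) (F b) ≡ shiftedCount b k
  high = count-cong _ _ (F b) (λ j _ → cong (λ s → does (s ≟ k)) (summandsE-high b j))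

-- The recurrence holds for every k.
proposition2p2 : (n k : ℕ) → 2 ≤ n → k ≤ (n + 1) / 2 →
    pℤ (+ n) (+ k) ≡ 2 * pℤ (+ n -ℤ + 2) (+ k -ℤ + 1) + pℤ (+ n -ℤ + 1) (+ k)
proposition2p2 (suc zero) k (s≤s ()) _
proposition2p2 (suc (suc b)) k _ _ = begin
  p (suc (suc b)) k
    ≡⟨ p-count (suc (suc b)) k ⟩
  count (λ m → summandsE (suc (suc b)) m ≟ k) (F (suc (suc b)))
    ≡⟨ count-recurrence b k ⟩
  count (λ m → summandsE (suc b) m ≟ k) (F (suc b)) + 2 * shiftedCount b k
    ≡⟨ cong₂ _+_ (sym (p-count (suc b) k)) (cong (2 *_) (shiftedCount-pℤ b k)) ⟩
  p (suc b) k + 2 * pℤ (+ b) (+ k -ℤ + 1)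
    ≡⟨ +-comm (p (suc b) k) _ ⟩
  2 * pℤ (+ b) (+ k -ℤ + 1) + p (suc b) k ∎
  where open ≡-Reasoning
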